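{- Let $\mathcal{F}$ be a finite set of graphs and let $\mathcal{F}_b$ be the associated set of boundaried graphs. Let $(G,x)$ be a $p$-boundaried graph and let $(H_1,y^{(1)})$, $(H_2,y^{(2)})$ be properly $p$-boundaried graphs, where all three are pairwise boundary-compatible, $x=(x_1,\ldots,x_p)$ and $y^{(h)}=(y_1^{(h)},\ldots,y_p^{(h)})$ for $h=1,2$. If $(H_1,y^{(1)})$ and $(H_2,y^{(2)})$ are equivalent with respect to $\mathcal{F}_b$, then $(G,x)\oplus_b (H_1,y^{(1)})$ is $\mathcal{F}$-free if and only if $(G,x)\oplus_b (H_2,y^{(2)})$ is $\mathcal{F}$-free.
   Context: All graphs are finite, simple, undirected. A graph is $\mathcal{F}$-free if it has no induced subgraph isomorphic to a member of $\mathcal{F}$. A $p$-boundaried graph is a pair $(G,x)$ with $x=(x_1,\ldots,x_p)$ a $p$-tuple of distinct vertices of $G$ (the boundary; possibly empty); it is properly $p$-boundaried if every component of $G$ contains a boundary vertex. Two $p$-boundaried graphs $(G_1,x^{(1)})$, $(G_2,x^{(2)})$ are isomorphic if there is a graph isomorphism $G_1\to G_2$ mapping $x^{(1)}_i$ to $x^{(2)}_i$ for all $i$; they are boundary-compatible if for all distinct $i,j$, $x_i^{(1)}x_j^{(1)}\in E(G_1)$ iff $x_i^{(2)}x_j^{(2)}\in E(G_2)$. For boundary-compatible ones, the boundary sum $(G_1,x^{(1)})\oplus_b(G_2,x^{(2)})$ is the (non-boundaried) graph obtained from disjoint copies of $G_1,G_2$ by identifying $x_i^{(1)}$ with $x_i^{(2)}$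 for each $i$. A separation of a graph $F$ is a pair $(A,B)$ with $A\cup B=V(F)$ and no edge between $A\setminus B$ and $B\setminus A$. For a graph $G$ and a $p$-tuple $y=(y_1,\ldots,y_p)$ of vertices of $G$, an $s$-boundaried graph $(H,(z_1,\ldots,z_s))$ and pairwise distinct $i_1,\ldots,i_s\in\{1,\ldots,p\}$, $H$ is an induced boundaried subgraph of $G$ with respect to $(y_{i_1},\ldots,y_{i_s})$ if $G$ has an induced subgraph $H'$ and an isomorphism $H\to H'$ mapping $z_j$ to $y_{i_j}$ for all $j$, with $V(H')\cap\{y_1,\ldots,y_p\}=\{y_{i_1},\ldots,y_{i_s}\}$. The set $\mathcal{F}_b$: for each $F\in\mathcal{F}$, each separation $(A,B)$ of $F$ and each ordering $x$ of $A\cap B$ as a $|A\cap B|$-tuple, $(F[A],x)$ is included in $\mathcal{F}_b$ (up to isomorphism of boundaried graphs). Two properly $p$-boundaried graphs $(G_1,x^{(1)})$, $(G_2,x^{(2)})$ are equivalent with respect to $\mathcal{F}_b$ if (i) they are boundary-compatible; (ii) for all $i,j$, $x_i^{(1)},x_j^{(1)}$ lie in the same component of $G_1$ iff $x_i^{(2)},x_j^{(2)}$ lie in the same component of $G_2$; (iii) for all pairwise distinct $i_1,\ldots,i_s\in\{1,\ldots,p\}$ and every $s$-boundaried $H\in\mathcal{F}_b$, $H$ is an induced boundaried subgraph of $G_1$ with respect to $(x^{(1)}_{i_1},\ldots,x^{(1)}_{i_s})$ iff $H$ is an induced boundaried subgraph of $G_2$ with respect to $(x^{(2)}_{i_1},\ldots,x^{(2)}_{i_s})$.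 -}

module Defs where

open import Data.Nat using (ℕ; zero; suc)
open import Data.Fin using (Fin; zero; suc; _≟_)
open import Data.Bool using (Bool; true; false; _∧_; _∨_; not; T)
open import Data.Sum using (_⊎_; inj₁; inj₂)
open import Data.Product using (Σ; ∃; ∃-syntax; _×_; _,_; proj₁)
open import Data.List using (List)
open import Data.List.Membership.Propositional using (_∈_)
open import Relation.Nullary using (¬_)
open import Relation.Nullary.Decidable using (⌊_⌋)
open import Relation.Binary.PropositionalEquality using (_≡_; _≢_)
open import Function.Definitions using (Injective)

record Graph : Set where
  field
    n      : ℕ
    adj    : Fin n → Fin n → Bool
    sym    : ∀ u v → adj u v ≡ adj v u
    irrefl : ∀ u → adj u u ≡ false
open Graph public

-- Only used
-- as the carrier of boundary sums (which are finite simple graphs, but we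
-- do not need to re-enumerate their vertex set to talk about
-- induced subgraphs of them).
record LGraph : Set₁ where
  field
    V    : Set
    ladj : V → V → Bool
open LGraph public

toL : Graph → LGraph
toL G = record { V = Fin (n G) ; ladj = adj G }

InducedSub : Graph → LGraph → Set
InducedSub F L =
  Σ (Fin (n F) → V L) λ φ →
    Injective _≡_ _≡_ φ × (∀ a b → adj F a b ≡ ladj L (φ a) (φ b))

Free : List Graph → LGraph → Set
Free 𝓕 L = ∀ F → F ∈ 𝓕 → ¬ InducedSub F L

record BGraph (p : ℕ) : Set where
  field
    G    : Graph
    bd   : Fin p → Fin (n G)
    bdInj : Injective _≡_ _≡_ bd
open BGraph public

data Conn (H : Graph) : Fin (n H) → Fin (n H) → Set where
  here : ∀ {u} → Conn H u u
  step : ∀ {u v w} → adj H u v ≡ true → Conn H v w → Conn H u w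

Properly : ∀ {p} → BGraph p → Set
Properly X = ∀ v → ∃[ i ] Conn (G X) v (bd X i)

BoundaryCompatible : ∀ {p} → BGraph p → BGraph p → Set
BoundaryCompatible X Y =
  ∀ i j → i ≢ j → adj (G X) (bd X i) (bd X j) ≡ adj (G Y) (bd Y i) (bd Y j)

anyFin : ∀ {p} → (Fin p → Bool) → Bool
anyFin {zero}  f = false
anyFin {suc p} f = f zero ∨ anyFin (λ i → f (suc i))

isBd : ∀ {p} (X : BGraph p) → Fin (n (G X)) → Bool
isBd X v = anyFin (λ i → ⌊ bd X i ≟ v ⌋)

-- Boundary sum: vertices of X, plus the non-boundary vertices of Y;
-- boundary vertex bd Y i is identified with bd X i.
SumV : ∀ {p} → BGraph p → BGraph p → Set
SumV X Y = Fin (n (G X)) ⊎ Σ (Fin (n (G Y))) (λ v → T (not (isBd Y v)))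

sumAdj : ∀ {p} (X Y : BGraph p) → SumV X Y → SumV X Y → Bool
sumAdj X Y (inj₁ a) (inj₁ b) = adj (G X) a b
sumAdj X Y (inj₂ (u , _)) (inj₂ (v , _)) = adj (G Y) u v
sumAdj X Y (inj₁ a) (inj₂ (v , _)) =
  anyFin (λ i → ⌊ bd X i ≟ a ⌋ ∧ adj (G Y) (bd Y i) v)
sumAdj X Y (inj₂ (v , _)) (inj₁ a) =
  anyFin (λ i → ⌊ bd X i ≟ a ⌋ ∧ adj (G Y) (bd Y i) v)

_⊕b_ : ∀ {p} → BGraph p → BGraph p → LGraph
X ⊕b Y = record { V = SumV X Y ; ladj = sumAdj X Y }

-- The set 𝓕_b: H ∈ 𝓕_b iff H is isomorphic (as boundaried graph) to
-- (F[A], x) for some F ∈ 𝓕, separation (A,B) of F, and ordering x of A∩B.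
-- Unfolded: an induced embedding φ of H into F with image exactly A,
-- and with j ↦ φ (z_j) enumerating A ∩ B.

IsSeparation : (F : Graph) → (Fin (n F) → Bool) → (Fin (n F) → Bool) → Set
IsSeparation F A B =
  (∀ v → (A v ∨ B v) ≡ true) ×
  (∀ u v → A u ≡ true → B u ≡ false → B v ≡ true → A v ≡ false →
     adj F u v ≡ false)

InFb : List Graph → ∀ {s} → BGraph s → Set
InFb 𝓕 {s} H =
  Σ Graph λ F → F ∈ 𝓕 ×
  Σ (Fin (n F) → Bool) λ A → Σ (Fin (n F) → Bool) λ B →
  IsSeparation F A B ×
  Σ (Fin (n (G H)) → Fin (n F)) λ φ →
    Injective _≡_ _≡_ φ ×
    (∀ a b → adj (G H) a b ≡ adj F (φ a) (φ b)) ×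
    (∀ v → (A v ≡ true → ∃[ a ] φ a ≡ v) × (∀ a → φ a ≡ v → A v ≡ true)) ×
    (∀ v → ((A v ∧ B v) ≡ true → ∃[ j ] φ (bd H j) ≡ v)
         × (∀ j → φ (bd H j) ≡ v → (A v ∧ B v) ≡ true))

-- H (s-boundaried) is an induced boundaried subgraph of (G', y) w.r.t.
-- (y_{ι 1}, …, y_{ι s})   (ι injective)
InducedBSub : ∀ {s p} → BGraph s → BGraph p → (Fin s → Fin p) → Set
InducedBSub H X ι =
  Σ (Fin (n (G H)) → Fin (n (G X))) λ φ →
    Injective _≡_ _≡_ φ ×
    (∀ a b → adj (G H) a b ≡ adj (G X) (φ a) (φ b)) ×
    (∀ j → φ (bd H j) ≡ bd X (ι j)) ×
    (∀ a i → φ a ≡ bd X i → ∃[ j ] ι j ≡ i)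

_↔_ : Set → Set → Set
P ↔ Q = (P → Q) × (Q → P)

Equivalent : List Graph → ∀ {p} → BGraph p → BGraph p → Set
Equivalent 𝓕 {p} X Y =
  BoundaryCompatible X Y ×
  (∀ i j → Conn (G X) (bd X i) (bd X j) ↔ Conn (G Y) (bd Y i) (bd Y j)) ×
  (∀ s (ι : Fin s → Fin p) → Injective _≡_ _≡_ ι →
     (H : BGraph s) → InFb 𝓕 H →
     InducedBSub H X ι ↔ InducedBSub H Y ι)

-- An induced copy ψ of F ∈ 𝓕 in X ⊕b H₁ cuts F along a separation (A , B), where ψ sends A
-- into H₁ (boundary included) and B into X. Then F[A], with boundary A ∩ B ordered by the
-- boundary positions ψ puts it on, lies in 𝓕_b and is an induced boundaried subgraph of H₁
-- at those positions. By equivalence it is also one of H₂ at the same positions, and gluing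
-- that copy to the X-part of ψ gives an induced copy of F in X ⊕b H₂.
module Submission where

open import Defs hiding (sym)
open import Data.Nat using (ℕ; suc)
open import Data.Fin using (Fin; zero; suc; _≟_)
open import Data.Bool using (Bool; true; false; _∧_; _∨_; not; T)
import Data.Bool as Bool
open import Data.Bool.Properties using (∨-zeroʳ; ∧-identityʳ; ∧-conicalˡ; ∧-conicalʳ; ¬-not; T-irrelevant)
open import Data.Sum using (inj₁; inj₂)
open import Data.Sum.Properties using (inj₁-injective; inj₂-injective)
open import Data.Product using (Σ; ∃-syntax; _×_; _,_; proj₁; proj₂)
open import Data.List using (List; _∷_; length; lookup; filter; allFin)
open import Data.List.Membership.Propositional using (_∈_)
import Data.List.Relation.Unary.All as All
import Data.List.Relation.Unary.AllPairs as AllPairs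
open import Data.List.Relation.Unary.Any using (index)
open import Data.List.Relation.Unary.Any.Properties using (lookup-index)
open import Data.List.Relation.Unary.Unique.Propositional using (Unique)
import Data.List.Relation.Unary.Unique.Propositional.Properties as Unique
open import Data.List.Membership.Propositional.Properties using (∈-filter⁺; ∈-filter⁻; ∈-allFin; ∈-lookup)
open import Data.Unit using (tt)
open import Relation.Nullary using (Dec; yes; no; contradiction)
open import Relation.Nullary.Decidable using (⌊_⌋; dec-true; isYes≗does)
open import Level using (0ℓ)
open import Relation.Unary using (Pred; Decidable)
open import Relation.Binary.PropositionalEquality
open import Function using (_∘_)
open import Function.Definitions using (Injective)

⌊⌋-true⇒ : ∀ {A : Set} (a? : Dec A) → ⌊ a? ⌋ ≡ true → A
⌊⌋-true⇒ (yes a) _ = a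

⌊⌋-true⇐ : ∀ {A : Set} (a? : Dec A) → A → ⌊ a? ⌋ ≡ true
⌊⌋-true⇐ a? a = trans (isYes≗does a?) (dec-true a? a)

true-iff⇒≡ : ∀ {b c : Bool} → (b ≡ true → c ≡ true) → (c ≡ true → b ≡ true) → b ≡ c
true-iff⇒≡ {true}  {true}  _ _ = refl
true-iff⇒≡ {true}  {false} b⇒c _ = contradiction (b⇒c refl) λ ()
true-iff⇒≡ {false} {true}  _ c⇒b = contradiction (c⇒b refl) λ ()
true-iff⇒≡ {false} {false} _ _ = refl

anyFin-witness : ∀ {p} (f : Fin p → Bool) → anyFin f ≡ true → ∃[ i ] f i ≡ true
anyFin-witness {suc p} f h with f zero in f0
... | true  = zero , f0
... | false = let i , fi = anyFin-witness (f ∘ suc) h in suc i , fi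

anyFin-intro : ∀ {p} (f : Fin p → Bool) {i} → f i ≡ true → anyFin f ≡ true
anyFin-intro f {zero}  fi = cong (_∨ anyFin (f ∘ suc)) fi
anyFin-intro f {suc i} fi = trans (cong (f zero ∨_) (anyFin-intro (f ∘ suc) fi)) (∨-zeroʳ (f zero))

module _ {p} (X : BGraph p) where

  isBd⇒bd : ∀ {a} → isBd X a ≡ true → ∃[ i ] bd X i ≡ a
  isBd⇒bd {a} h = let i , q = anyFin-witness _ h in i , ⌊⌋-true⇒ (bd X i ≟ a) q

  isBd-bd : ∀ i → isBd X (bd X i) ≡ true
  isBd-bd i = anyFin-intro (λ k → ⌊ bd X k ≟ bd X i ⌋) (⌊⌋-true⇐ (bd X i ≟ bd X i) refl)

  atBoundary : Fin (n (G X)) → (Fin p → Bool) → Bool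
  atBoundary a g = anyFin (λ i → ⌊ bd X i ≟ a ⌋ ∧ g i)

  atBoundary⇒ : ∀ {a g} → atBoundary a g ≡ true → ∃[ i ] bd X i ≡ a × g i ≡ true
  atBoundary⇒ {a} h =
    let i , q = anyFin-witness _ h in i , ⌊⌋-true⇒ (bd X i ≟ a) (∧-conicalˡ _ _ q) , ∧-conicalʳ _ _ q

  atBoundary-bd : ∀ i g → atBoundary (bd X i) g ≡ g i
  atBoundary-bd i g = true-iff⇒≡ forward (λ gi → anyFin-intro (λ k → ⌊ bd X k ≟ bd X i ⌋ ∧ g k) (cong₂ _∧_ (⌊⌋-true⇐ (bd X i ≟ bd X i) refl) gi))
    where
    forward : atBoundary (bd X i) g ≡ true → g i ≡ true
    forward h = let k , bk≡bi , gk = atBoundary⇒ h in subst (λ k → g k ≡ true) (bdInj X bk≡bi) gk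

  atBoundary-nonBd : ∀ {a} g → isBd X a ≡ false → atBoundary a g ≡ false
  atBoundary-nonBd g ¬bd = ¬-not λ h →
    let i , bi≡a , _ = atBoundary⇒ {g = g} h in
    contradiction (trans (sym ¬bd) (subst (λ a → isBd X a ≡ true) bi≡a (isBd-bd i))) λ ()

lookup-injective : ∀ {A : Set} {xs : List A} → Unique xs → Injective _≡_ _≡_ (lookup xs)
lookup-injective {xs = x ∷ xs} (x∉xs AllPairs.∷ u) {zero}  {zero}  _ = refl
lookup-injective {xs = x ∷ xs} (x∉xs AllPairs.∷ u) {zero}  {suc j} x≡xⱼ = contradiction x≡xⱼ (All.lookup x∉xs (∈-lookup j))
lookup-injective {xs = x ∷ xs} (x∉xs AllPairs.∷ u) {suc i} {zero}  xᵢ≡x = contradiction (sym xᵢ≡x) (All.lookup x∉xs (∈-lookup i))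
lookup-injective {xs = x ∷ xs} (x∉xs AllPairs.∷ u) {suc i} {suc j} xᵢ≡xⱼ = cong suc (lookup-injective u xᵢ≡xⱼ)

record Enumeration {k} (P : Pred (Fin k) 0ℓ) : Set where
  field
    size           : ℕ
    elem           : Fin size → Fin k
    elem-injective : Injective _≡_ _≡_ elem
    elem-satisfies : ∀ j → P (elem j)
    index-of       : ∀ {v} → P v → Fin size
    elem-index-of  : ∀ {v} (pv : P v) → elem (index-of pv) ≡ v

enumerate : ∀ {k} {P : Pred (Fin k) 0ℓ} → Decidable P → Enumeration P
enumerate {k} P? = record
  { size           = length xs
  ; elem           = lookup xs
  ; elem-injective = lookup-injective (Unique.filter⁺ P? (Unique.allFin⁺ k))
  ; elem-satisfies = λ j → proj₂ (∈-filter⁻ P? {xs = allFin k} (∈-lookup j))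
  ; index-of       = λ {v} pv → index (∈-filter⁺ P? (∈-allFin v) pv)
  ; elem-index-of  = λ {v} pv → sym (lookup-index (∈-filter⁺ P? (∈-allFin v) pv))
  }
  where
  xs : List (Fin k)
  xs = filter P? (allFin k)

compatible-bd : ∀ {p} {X Y : BGraph p} → BoundaryCompatible X Y →
  ∀ i j → adj (G X) (bd X i) (bd X j) ≡ adj (G Y) (bd Y i) (bd Y j)
compatible-bd {X = X} {Y} compat i j with i ≟ j
... | yes refl = trans (irrefl (G X) (bd X i)) (sym (irrefl (G Y) (bd Y i)))
... | no  i≢j  = compat i j i≢j

module BoundarySum {p} (X Y : BGraph p) where

  onY : SumV X Y → Bool
  onY (inj₁ a) = isBd X a
  onY (inj₂ _) = true

  onX : SumV X Y → Bool
  onX (inj₁ _) = true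
  onX (inj₂ _) = false

  sumAdj-bd-inj₂ : ∀ i y → sumAdj X Y (inj₁ (bd X i)) (inj₂ y) ≡ adj (G Y) (bd Y i) (proj₁ y)
  sumAdj-bd-inj₂ i (y , _) = atBoundary-bd X i (λ k → adj (G Y) (bd Y k) y)

  sumAdj-nonBd-inj₂ : ∀ {a} y → isBd X a ≡ false → sumAdj X Y (inj₁ a) (inj₂ y) ≡ false
  sumAdj-nonBd-inj₂ (y , _) = atBoundary-nonBd X (λ k → adj (G Y) (bd Y k) y)

  embedding-separation : ∀ {F} ((ψ , _ , ψ-adj) : InducedSub F (X ⊕b Y)) →
    IsSeparation F (onY ∘ ψ) (onX ∘ ψ)
  embedding-separation (ψ , _ , ψ-adj) = (λ v → covers (ψ v)) , λ u v _ ¬Xu _ ¬Yv →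
    trans (ψ-adj u v) (nonadjacent (ψ u) (ψ v) ¬Xu ¬Yv)
    where
    covers : ∀ w → (onY w ∨ onX w) ≡ true
    covers (inj₁ a) = ∨-zeroʳ (isBd X a)
    covers (inj₂ _) = refl
    nonadjacent : ∀ w w' → onX w ≡ false → onY w' ≡ false → sumAdj X Y w w' ≡ false
    nonadjacent (inj₂ y) (inj₁ a) _  ¬bd = sumAdj-nonBd-inj₂ y ¬bd
    nonadjacent (inj₁ _) _        () _
    nonadjacent (inj₂ _) (inj₂ _) _  ()

  onBoth⇒bd : ∀ w → onY w ∧ onX w ≡ true → ∃[ i ] w ≡ inj₁ (bd X i)
  onBoth⇒bd (inj₁ a) h = let i , bi≡a = isBd⇒bd X (∧-conicalˡ _ _ h) in i , cong inj₁ (sym bi≡a)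
  onBoth⇒bd (inj₂ _) ()

  bd-onBoth : ∀ i → onY (inj₁ (bd X i)) ∧ onX (inj₁ (bd X i)) ≡ true
  bd-onBoth i = trans (∧-identityʳ _) (isBd-bd X i)

  toY : ∀ w → onY w ≡ true → Fin (n (G Y))
  toY (inj₁ a)       h = bd Y (proj₁ (isBd⇒bd X h))
  toY (inj₂ (y , _)) _ = y

  toY-bd : ∀ {w} h {i} → w ≡ inj₁ (bd X i) → toY w h ≡ bd Y i
  toY-bd h refl = cong (bd Y) (bdInj X (proj₂ (isBd⇒bd X h)))

  toY≡bd⇒ : ∀ w h {i} → toY w h ≡ bd Y i → w ≡ inj₁ (bd X i)
  toY≡bd⇒ (inj₁ a) h e = cong inj₁ (trans (sym (proj₂ (isBd⇒bd X h))) (cong (bd X) (bdInj Y e)))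
  toY≡bd⇒ (inj₂ (y , interior)) _ {i} refl = contradiction (isBd-bd Y i) (λ bd → subst (T ∘ not) bd interior)

  toY-injective : ∀ w w' h h' → toY w h ≡ toY w' h' → w ≡ w'
  toY-injective w (inj₁ a) h h' e = trans (toY≡bd⇒ w h e) (cong inj₁ (proj₂ (isBd⇒bd X h')))
  toY-injective (inj₁ a) (inj₂ y) h h' e = sym (toY-injective (inj₂ y) (inj₁ a) h' h (sym e))
  toY-injective (inj₂ (y , t)) (inj₂ (.y , t')) _ _ refl = cong (λ t → inj₂ (y , t)) (T-irrelevant t t')

  toY-adj : BoundaryCompatible X Y → ∀ w w' h h' → sumAdj X Y w w' ≡ adj (G Y) (toY w h) (toY w' h')
  toY-adj compat (inj₁ a) (inj₁ a') h h' =
    let i , bi≡a = isBd⇒bd X h ; j , bj≡a' = isBd⇒bd X h' in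
    subst₂ (λ a a' → adj (G X) a a' ≡ adj (G Y) (bd Y i) (bd Y j)) bi≡a bj≡a' (compatible-bd {X = X} {Y} compat i j)
  toY-adj compat (inj₁ a) (inj₂ y) h _ =
    let i , bi≡a = isBd⇒bd X h in
    subst (λ a → sumAdj X Y (inj₁ a) (inj₂ y) ≡ adj (G Y) (bd Y i) (proj₁ y)) bi≡a (sumAdj-bd-inj₂ i y)
  toY-adj compat (inj₂ y) (inj₁ a) h h' = trans (toY-adj compat (inj₁ a) (inj₂ y) h' h) (Graph.sym (G Y) _ _)
  toY-adj compat (inj₂ _) (inj₂ _) _ _ = refl

restrict : (F : Graph) {m : ℕ} → (Fin m → Fin (n F)) → Graph
restrict F {m} e = record
  { n      = m
  ; adj    = λ a b → adj F (e a) (e b)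
  ; sym    = λ a b → Graph.sym F (e a) (e b)
  ; irrefl = λ a → irrefl F (e a)
  }

TracesIncluded : List Graph → ∀ {p} → BGraph p → BGraph p → Set
TracesIncluded 𝓕 {p} Ha Hb = ∀ s (ι : Fin s → Fin p) → Injective _≡_ _≡_ ι →
  (H : BGraph s) → InFb 𝓕 H → InducedBSub H Ha ι → InducedBSub H Hb ι

module Transfer (𝓕 : List Graph) {p} (X Ha Hb : BGraph p) (compat : BoundaryCompatible X Ha)
  {F : Graph} (F∈𝓕 : F ∈ 𝓕) (emb : InducedSub F (X ⊕b Ha)) where

  module Sa = BoundarySum X Ha
  module Sb = BoundarySum X Hb

  ψ : Fin (n F) → SumV X Ha
  ψ = proj₁ emb

  ψ-injective : Injective _≡_ _≡_ ψ
  ψ-injective = proj₁ (proj₂ emb)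

  ψ-adj : ∀ u v → adj F u v ≡ sumAdj X Ha (ψ u) (ψ v)
  ψ-adj = proj₂ (proj₂ emb)

  A B : Fin (n F) → Bool
  A = Sa.onY ∘ ψ
  B = Sa.onX ∘ ψ

  module V  = Enumeration (enumerate (λ v → A v Bool.≟ true))
  module Bd = Enumeration (enumerate (λ v → A v ∧ B v Bool.≟ true))

  trace-bd : Fin Bd.size → Fin V.size
  trace-bd j = V.index-of (∧-conicalˡ _ _ (Bd.elem-satisfies j))

  elem-trace-bd : ∀ j → V.elem (trace-bd j) ≡ Bd.elem j
  elem-trace-bd j = V.elem-index-of (∧-conicalˡ _ _ (Bd.elem-satisfies j))

  trace : BGraph Bd.size
  trace = record
    { G     = restrict F V.elem
    ; bd    = trace-bd
    ; bdInj = λ {j} {j'} e → Bd.elem-injective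
        (trans (sym (elem-trace-bd j)) (trans (cong V.elem e) (elem-trace-bd j')))
    }

  ι : Fin Bd.size → Fin p
  ι j = proj₁ (Sa.onBoth⇒bd (ψ (Bd.elem j)) (Bd.elem-satisfies j))

  ι-spec : ∀ j → ψ (Bd.elem j) ≡ inj₁ (bd X (ι j))
  ι-spec j = proj₂ (Sa.onBoth⇒bd (ψ (Bd.elem j)) (Bd.elem-satisfies j))

  ι-injective : Injective _≡_ _≡_ ι
  ι-injective {j} {j'} e = Bd.elem-injective (ψ-injective
    (trans (ι-spec j) (trans (cong (λ i → inj₁ (bd X i)) e) (sym (ι-spec j')))))

  ψ-trace-bd : ∀ j → ψ (V.elem (trace-bd j)) ≡ inj₁ (bd X (ι j))
  ψ-trace-bd j = trans (cong ψ (elem-trace-bd j)) (ι-spec j)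

  boundary-position : ∀ {u i} → ψ u ≡ inj₁ (bd X i) → ∃[ j ] Bd.elem j ≡ u × ι j ≡ i
  boundary-position {u} {i} e = j , Bd.elem-index-of onBoth ,
    bdInj X (inj₁-injective (trans (sym (ι-spec j)) (trans (cong ψ (Bd.elem-index-of onBoth)) e)))
    where
    onBoth : A u ∧ B u ≡ true
    onBoth = subst (λ w → Sa.onY w ∧ Sa.onX w ≡ true) (sym e) (Sa.bd-onBoth i)
    j : Fin Bd.size
    j = Bd.index-of onBoth

  trace∈Fb : InFb 𝓕 trace
  trace∈Fb = F , F∈𝓕 , A , B , Sa.embedding-separation {F} emb ,
    V.elem , V.elem-injective , (λ _ _ → refl) ,
    (λ v → (λ Av → V.index-of Av , V.elem-index-of Av) ,
           (λ a e → subst (λ v → A v ≡ true) e (V.elem-satisfies a))) ,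
    (λ v → (λ ABv → Bd.index-of ABv , trans (elem-trace-bd _) (Bd.elem-index-of ABv)) ,
           (λ j e → subst (λ v → A v ∧ B v ≡ true) (trans (sym (elem-trace-bd j)) e) (Bd.elem-satisfies j)))

  trace-in-Ha : InducedBSub trace Ha ι
  trace-in-Ha = φ ,
    (λ e → V.elem-injective (ψ-injective (Sa.toY-injective (ψ (V.elem _)) (ψ (V.elem _)) _ _ e))) ,
    (λ a b → trans (ψ-adj (V.elem a) (V.elem b)) (Sa.toY-adj compat (ψ (V.elem a)) (ψ (V.elem b)) _ _)) ,
    (λ j → Sa.toY-bd _ (ψ-trace-bd j)) ,
    (λ a i e → let j , _ , ιj≡i = boundary-position (Sa.toY≡bd⇒ _ _ e) in j , ιj≡i)
    where
    φ : Fin V.size → Fin (n (G Ha))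
    φ a = Sa.toY (ψ (V.elem a)) (V.elem-satisfies a)

  module Lift (trace-in-Hb : InducedBSub trace Hb ι) where

    φ : Fin V.size → Fin (n (G Hb))
    φ = proj₁ trace-in-Hb

    φ-injective : Injective _≡_ _≡_ φ
    φ-injective = proj₁ (proj₂ trace-in-Hb)

    φ-adj : ∀ a b → adj F (V.elem a) (V.elem b) ≡ adj (G Hb) (φ a) (φ b)
    φ-adj = proj₁ (proj₂ (proj₂ trace-in-Hb))

    φ-bd : ∀ j → φ (trace-bd j) ≡ bd Hb (ι j)
    φ-bd = proj₁ (proj₂ (proj₂ (proj₂ trace-in-Hb)))

    φ-bd⁻¹ : ∀ a i → φ a ≡ bd Hb i → ∃[ j ] ι j ≡ i
    φ-bd⁻¹ = proj₂ (proj₂ (proj₂ (proj₂ trace-in-Hb)))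

    φ≡bd⇒ : ∀ a {i} → φ a ≡ bd Hb i → ψ (V.elem a) ≡ inj₁ (bd X i)
    φ≡bd⇒ a {i} e = begin
      ψ (V.elem a)             ≡⟨ cong (ψ ∘ V.elem) bdj≡a ⟨
      ψ (V.elem (trace-bd j))  ≡⟨ ψ-trace-bd j ⟩
      inj₁ (bd X (ι j))        ≡⟨ cong (λ i → inj₁ (bd X i)) ιj≡i ⟩
      inj₁ (bd X i)            ∎
      where
      open ≡-Reasoning
      j : Fin Bd.size
      j = proj₁ (φ-bd⁻¹ a i e)
      ιj≡i : ι j ≡ i
      ιj≡i = proj₂ (φ-bd⁻¹ a i e)
      bdj≡a : trace-bd j ≡ a
      bdj≡a = φ-injective (trans (φ-bd j) (trans (cong (bd Hb) ιj≡i) (sym e)))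

    φ-interior : ∀ a {y} → ψ (V.elem a) ≡ inj₂ y → T (not (isBd Hb (φ a)))
    φ-interior a ψa≡y = subst (T ∘ not) (sym φa-interior) tt
      where
      φa-interior : isBd Hb (φ a) ≡ false
      φa-interior = ¬-not λ h →
        let i , bi≡φa = isBd⇒bd Hb h in
        contradiction (trans (sym (φ≡bd⇒ a (sym bi≡φa))) ψa≡y) λ ()

    hb : ∀ v → A v ≡ true → Fin (n (G Hb))
    hb v Av = φ (V.index-of Av)

    hb-adj : ∀ u v Au Av → adj F u v ≡ adj (G Hb) (hb u Au) (hb v Av)
    hb-adj u v Au Av =
      trans (cong₂ (adj F) (sym (V.elem-index-of Au)) (sym (V.elem-index-of Av))) (φ-adj _ _)

    hb-bd : ∀ u Au {i} → ψ u ≡ inj₁ (bd X i) → hb u Au ≡ bd Hb i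
    hb-bd u Au e with boundary-position e
    ... | j , refl , refl =
      trans (cong φ (V.elem-injective (trans (V.elem-index-of Au) (sym (elem-trace-bd j))))) (φ-bd j)

    interior : ∀ v {y} → ψ v ≡ inj₂ y → Σ (Fin (n (G Hb))) (λ b → T (not (isBd Hb b)))
    interior v e = hb v Av , φ-interior _ (trans (cong ψ (V.elem-index-of Av)) e)
      where
      Av : A v ≡ true
      Av = cong Sa.onY e

    -- lift v (ψ v) refl keeps ψ on X and replaces it by φ on the interior of Ha;
    -- the equation remembers which case ψ v is in.
    lift : ∀ v w → ψ v ≡ w → SumV X Hb
    lift v (inj₁ a) _ = inj₁ a
    lift v (inj₂ y) e = inj₂ (interior v e)

    lift-injective : ∀ u v wu wv (eu : ψ u ≡ wu) (ev : ψ v ≡ wv) → lift u wu eu ≡ lift v wv ev → u ≡ v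
    lift-injective u v (inj₁ _) (inj₁ _) eu ev e = ψ-injective (trans eu (trans (cong inj₁ (inj₁-injective e)) (sym ev)))
    lift-injective u v (inj₂ _) (inj₂ _) eu ev e =
      trans (sym (V.elem-index-of (cong Sa.onY eu)))
        (trans (cong V.elem (φ-injective (cong proj₁ (inj₂-injective e)))) (V.elem-index-of (cong Sa.onY ev)))

    lift-adj-cross : ∀ u v a y (eu : ψ u ≡ inj₁ a) (ev : ψ v ≡ inj₂ y) →
      adj F u v ≡ sumAdj X Hb (inj₁ a) (lift v (inj₂ y) ev)
    lift-adj-cross u v a y eu ev with isBd X a in isBd-a
    ... | false = begin
      adj F u v                            ≡⟨ ψ-adj u v ⟩
      sumAdj X Ha (ψ u) (ψ v)              ≡⟨ cong₂ (sumAdj X Ha) eu ev ⟩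
      sumAdj X Ha (inj₁ a) (inj₂ y)        ≡⟨ Sa.sumAdj-nonBd-inj₂ y isBd-a ⟩
      false                                ≡⟨ Sb.sumAdj-nonBd-inj₂ (interior v ev) isBd-a ⟨
      sumAdj X Hb (inj₁ a) (lift v (inj₂ y) ev) ∎
      where open ≡-Reasoning
    ... | true with isBd⇒bd X isBd-a
    ...   | i , refl = begin
      adj F u v                            ≡⟨ hb-adj u v Au Av ⟩
      adj (G Hb) (hb u Au) (hb v Av)       ≡⟨ cong (λ b → adj (G Hb) b (hb v Av)) (hb-bd u Au eu) ⟩
      adj (G Hb) (bd Hb i) (hb v Av)       ≡⟨ Sb.sumAdj-bd-inj₂ i (interior v ev) ⟨
      sumAdj X Hb (inj₁ (bd X i)) (lift v (inj₂ y) ev) ∎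
      where
      open ≡-Reasoning
      Au : A u ≡ true
      Au = trans (cong Sa.onY eu) isBd-a
      Av : A v ≡ true
      Av = cong Sa.onY ev

    lift-adj : ∀ u v wu wv (eu : ψ u ≡ wu) (ev : ψ v ≡ wv) → adj F u v ≡ sumAdj X Hb (lift u wu eu) (lift v wv ev)
    lift-adj u v (inj₁ a) (inj₁ b) eu ev = trans (ψ-adj u v) (cong₂ (sumAdj X Ha) eu ev)
    lift-adj u v (inj₁ a) (inj₂ y) eu ev = lift-adj-cross u v a y eu ev
    lift-adj u v (inj₂ y) (inj₁ a) eu ev = trans (Graph.sym F u v) (lift-adj-cross v u a y ev eu)
    lift-adj u v (inj₂ _) (inj₂ _) eu ev = hb-adj u v _ _

    lifted : InducedSub F (X ⊕b Hb)
    lifted = (λ v → lift v (ψ v) refl) ,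
             (λ {u} {v} → lift-injective u v (ψ u) (ψ v) refl refl) ,
             (λ u v → lift-adj u v (ψ u) (ψ v) refl refl)

  transfer : TracesIncluded 𝓕 Ha Hb → InducedSub F (X ⊕b Hb)
  transfer Ha⇒Hb = Lift.lifted (Ha⇒Hb Bd.size ι ι-injective trace trace∈Fb trace-in-Ha)

mainTheorem10 : (𝓕 : List Graph) (p : ℕ) (X H₁ H₂ : BGraph p) →
    Properly H₁ → Properly H₂ →
    BoundaryCompatible X H₁ → BoundaryCompatible X H₂ → BoundaryCompatible H₁ H₂ →
    Equivalent 𝓕 H₁ H₂ →
    Free 𝓕 (X ⊕b H₁) ↔ Free 𝓕 (X ⊕b H₂)
-- Only condition (iii) of equivalence is used.
mainTheorem10 𝓕 p X H₁ H₂ _ _ compat₁ compat₂ _ (_ , _ , sameTraces) =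
  (λ free₁ F F∈𝓕 emb₂ → free₁ F F∈𝓕 (Transfer.transfer 𝓕 X H₂ H₁ compat₂ F∈𝓕 emb₂ H₂⇒H₁)) ,
  (λ free₂ F F∈𝓕 emb₁ → free₂ F F∈𝓕 (Transfer.transfer 𝓕 X H₁ H₂ compat₁ F∈𝓕 emb₁ H₁⇒H₂))
  where
  H₁⇒H₂ : TracesIncluded 𝓕 H₁ H₂
  H₁⇒H₂ = λ s ι ι-injective H H∈Fb → proj₁ (sameTraces s ι ι-injective H H∈Fb)
  H₂⇒H₁ : TracesIncluded 𝓕 H₂ H₁
  H₂⇒H₁ = λ s ι ι-injective H H∈Fb → proj₂ (sameTraces s ι ι-injective H H∈Fb)
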